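{- There exist infinitely many permutations of $\mathbb{N}$ (bijections $\mathbb{N}\to\mathbb{N}$) which are pairwise divergent: for any two distinct ones $x=(x_1,x_2,\dots)$ and $y=(y_1,y_2,\dots)$, $|x_n-y_n|\to\infty$ as $n\to\infty$.
   Context: An infinite permutation is a bijection $x:\mathbb{N}\to\mathbb{N}$, written as the sequence $(x_1,x_2,\dots)$ with $x_n$ the entry in position $n$. Two infinite permutations $x,y$ diverge if $\lim_{n\to\infty}|x_n-y_n|=\infty$. -}

module Defs where

open import Data.Nat using (ℕ; _≤_; ∣_-_∣)
open import Data.Product using (∃-syntax)
open import Function.Bundles using (Bijection)
open import Level using (0ℓ)
open import Relation.Binary.PropositionalEquality using (setoid)

-- An infinite permutation: a bijection ℕ → ℕ (positions indexed from 0).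
InfPerm : Set
InfPerm = Bijection (setoid ℕ) (setoid ℕ)

seq : InfPerm → ℕ → ℕ
seq x = Bijection.to x

Diverge : InfPerm → InfPerm → Set
Diverge x y = ∀ (M : ℕ) → ∃[ N ] (∀ (n : ℕ) → N ≤ n → M ≤ ∣ seq x n - seq y n ∣)

module Submission where

-- Given g : ℕ → ℕ with g t > 0 and g (t + 1) ≥ 2 g t, cut ℕ into consecutive
-- blocks, block t having length 2 g t, and swap the two halves of every
-- block.  The result is an involution of ℕ (hence a permutation) which moves
-- every n by exactly g t for the block t containing it, and this block is
-- large compared with n: n < 4 g t.
--
-- For the family we take g_i t = 2 ^ ((i + t)² + i).  The exponents are
-- strictly increasing in t (so g_i doubles) and never coincide for distinct
-- i, and two distinct powers of two differ by at least the smaller one.  If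
-- n ≥ 4 M then both shifts g_i t, g_j s at n are ≥ M, and two shifts of n by
-- amounts a, b land at least a ⊓ b ≥ M apart; this is the divergence.

open import Defs
open import Data.Nat using (ℕ)
open import Data.Product using (Σ)
open import Relation.Binary.PropositionalEquality using (_≢_)

open import Data.Nat using (zero; suc; s≤s; _+_; _*_; _∸_; _^_; _≤_; _<_; _⊓_; _<?_; ∣_-_∣)
open import Data.Nat.Properties
open import Data.Nat.Tactic.RingSolver using (solve-∀)
open import Data.Product using (_,_; _×_; ∃)
open import Data.Sum using (_⊎_; inj₁; inj₂)
open import Function.Bundles using (mk↔ₛ′)
open import Function.Properties.Inverse using (↔⇒⤖)
open import Relation.Binary using (tri<; tri≈; tri>)
open import Relation.Binary.PropositionalEquality using (_≡_; refl; sym; trans; cong; cong₂; subst; subst₂; module ≡-Reasoning)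
open import Relation.Nullary using (yes; no)
open import Relation.Nullary.Negation using (contradiction)

involution⇒InfPerm : (f : ℕ → ℕ) → (∀ n → f (f n) ≡ n) → InfPerm
involution⇒InfPerm f inv = ↔⇒⤖ (mk↔ₛ′ f f inv inv)

Shifted : ℕ → ℕ → ℕ → Set
Shifted d n m = m ≡ n + d ⊎ m + d ≡ n

shifted-+ : ∀ k {d n m} → Shifted d n m → Shifted d (k + n) (k + m)
shifted-+ k {d} {n} (inj₁ m≡n+d) = inj₁ (trans (cong (k +_) m≡n+d) (sym (+-assoc k n d)))
shifted-+ k {d} {m = m} (inj₂ m+d≡n) = inj₂ (trans (+-assoc k m d) (cong (k +_) m+d≡n))

module BlockSwap (g : ℕ → ℕ) (g-pos : ∀ t → 0 < g t) where

  size : ℕ → ℕ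
  size t = g t + g t

  size-pos : ∀ t → 0 < size t
  size-pos t = <-≤-trans (g-pos t) (m≤m+n (g t) (g t))

  -- Where a position n, counted from the start of block t, lies.
  data Position (t n : ℕ) : Set where
    lower  : n < g t → Position t n
    upper  : g t ≤ n → n < size t → Position t n
    beyond : size t ≤ n → Position t n

  position : ∀ t n → Position t n
  position t n with n <? g t | n <? size t
  ... | yes n<g | _        = lower n<g
  ... | no n≮g  | yes n<2g = upper (≮⇒≥ n≮g) n<2g
  ... | no _    | no n≮2g  = beyond (≮⇒≥ n≮2g)

  -- swap f t n: the image of the position n counted from the start of block
  -- t, exchanging the halves of block t and of all later blocks; f is fuel.
  swap : ℕ → ℕ → ℕ → ℕ
  swap zero    t n = n
  swap (suc f) t n with position t n
  ... | lower _   = n + g t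
  ... | upper _ _ = n ∸ g t
  ... | beyond _  = size t + swap f (suc t) (n ∸ size t)

  swap-lower : ∀ f t n → n < g t → swap (suc f) t n ≡ n + g t
  swap-lower f t n n<g with position t n
  ... | lower _      = refl
  ... | upper g≤n _  = contradiction n<g (≤⇒≯ g≤n)
  ... | beyond 2g≤n  = contradiction (≤-trans (m≤m+n (g t) (g t)) 2g≤n) (<⇒≱ n<g)

  swap-upper : ∀ f t n → g t ≤ n → n < size t → swap (suc f) t n ≡ n ∸ g t
  swap-upper f t n g≤n n<2g with position t n
  ... | lower n<g   = contradiction n<g (≤⇒≯ g≤n)
  ... | upper _ _   = refl
  ... | beyond 2g≤n = contradiction n<2g (≤⇒≯ 2g≤n)

  swap-beyond : ∀ f t n → size t ≤ n →
                swap (suc f) t n ≡ size t + swap f (suc t) (n ∸ size t)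
  swap-beyond f t n 2g≤n with position t n
  ... | lower n<g    = contradiction (≤-trans (m≤m+n (g t) (g t)) 2g≤n) (<⇒≱ n<g)
  ... | upper _ n<2g = contradiction n<2g (≤⇒≯ 2g≤n)
  ... | beyond _     = refl

  -- Passing to the next block strictly decreases the position, so one unit
  -- of fuel is spent per block.
  next-fuel : ∀ t n f → size t ≤ n → n < suc f → n ∸ size t < f
  next-fuel t n f 2g≤n n<1+f = ≤-trans (∸-monoʳ-< (size-pos t) 2g≤n) (≤-pred n<1+f)

  swap-involutive : ∀ f f' t n → n < f → swap f t n < f' → swap f' t (swap f t n) ≡ n
  swap-involutive (suc f) (suc f') t n n<f m<f' with position t n
  ... | lower n<g =
    begin
      swap (suc f') t (n + g t) ≡⟨ swap-upper f' t (n + g t) (m≤n+m (g t) n) (+-monoˡ-< (g t) n<g) ⟩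
      n + g t ∸ g t             ≡⟨ m+n∸n≡m n (g t) ⟩
      n                         ∎
    where open ≡-Reasoning
  ... | upper g≤n n<2g =
    begin
      swap (suc f') t (n ∸ g t) ≡⟨ swap-lower f' t (n ∸ g t) n∸g<g ⟩
      n ∸ g t + g t             ≡⟨ m∸n+n≡m g≤n ⟩
      n                         ∎
    where
      open ≡-Reasoning
      n∸g<g : n ∸ g t < g t
      n∸g<g = +-cancelʳ-< (g t) (n ∸ g t) (g t) (subst (_< size t) (sym (m∸n+n≡m g≤n)) n<2g)
  ... | beyond 2g≤n =
    begin
      swap (suc f') t (size t + m)                  ≡⟨ swap-beyond f' t (size t + m) (m≤m+n (size t) m) ⟩
      size t + swap f' (suc t) (size t + m ∸ size t) ≡⟨ cong (λ k → size t + swap f' (suc t) k) (m+n∸m≡n (size t) m) ⟩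
      size t + swap f' (suc t) m                    ≡⟨ cong (size t +_) (swap-involutive f f' (suc t) (n ∸ size t) n'<f m<f'-1) ⟩
      size t + (n ∸ size t)                         ≡⟨ m+[n∸m]≡n 2g≤n ⟩
      n                                             ∎
    where
      open ≡-Reasoning
      m : ℕ
      m = swap f (suc t) (n ∸ size t)
      n'<f : n ∸ size t < f
      n'<f = next-fuel t n f 2g≤n n<f
      m<f'-1 : m < f'
      m<f'-1 = ≤-trans (+-monoˡ-≤ m (size-pos t)) (≤-pred m<f')

  -- The block swap of ℕ: blocks start at 0, and fuel n + 1 suffices for n.
  blockSwap : ℕ → ℕ
  blockSwap n = swap (suc n) 0 n

  blockSwap-involutive : ∀ n → blockSwap (blockSwap n) ≡ n
  blockSwap-involutive n = swap-involutive (suc n) (suc (blockSwap n)) 0 n (n<1+n n) (n<1+n (blockSwap n))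

  blockSwapPerm : InfPerm
  blockSwapPerm = involution⇒InfPerm blockSwap blockSwap-involutive

  -- Under doubling, each block is at least as long as all earlier ones together.
  module Shift (doubling : ∀ t → size t ≤ g (suc t)) where

    -- If block t starts at absolute position B < size t, the position n of
    -- that block or a later one is shifted by g t' for a block t' which is
    -- large: the absolute position B + n is below 4 g t'.
    swap-shift : ∀ f t n B → n < f → B < size t →
                 ∃ λ t' → B + n < size t' + size t' × Shifted (g t') n (swap f t n)
    swap-shift (suc f) t n B n<f B<2g with position t n
    ... | lower n<g = t , +-mono-< B<2g (<-≤-trans n<g (m≤m+n (g t) (g t))) , inj₁ refl
    ... | upper g≤n n<2g = t , +-mono-< B<2g n<2g , inj₂ (m∸n+n≡m g≤n)
    ... | beyond 2g≤n
      with swap-shift f (suc t) (n ∸ size t) (B + size t) (next-fuel t n f 2g≤n n<f) B'<2g'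
      where
        B'<2g' : B + size t < size (suc t)
        B'<2g' = <-≤-trans (+-monoˡ-< (size t) B<2g) (+-mono-≤ (doubling t) (doubling t))
    ... | t' , bound , shifted =
      t' , subst (_< size t' + size t') absolute bound
         , subst (λ k → Shifted (g t') k (size t + swap f (suc t) (n ∸ size t))) (m+[n∸m]≡n 2g≤n) (shifted-+ (size t) shifted)
      where
        absolute : B + size t + (n ∸ size t) ≡ B + n
        absolute = trans (+-assoc B (size t) (n ∸ size t)) (cong (B +_) (m+[n∸m]≡n 2g≤n))

    blockSwap-shift : ∀ n → ∃ λ t → n < size t + size t × Shifted (g t) n (blockSwap n)
    blockSwap-shift n = swap-shift (suc n) 0 n 0 (n<1+n n) (size-pos 0)

both-down : ∀ {a b n u v} → u + a ≡ n → v + b ≡ n → ∣ u - v ∣ ≡ ∣ a - b ∣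
both-down {a} {b} {n} {u} {v} u+a≡n v+b≡n = begin
  ∣ u - v ∣                     ≡⟨ sym (∣m+n-m+o∣≡∣n-o∣ (a + b) u v) ⟩
  ∣ (a + b) + u - (a + b) + v ∣ ≡⟨ cong₂ ∣_-_∣ (pad u a b u+a≡n) (trans (cong (_+ v) (+-comm a b)) (pad v b a v+b≡n)) ⟩
  ∣ n + b - n + a ∣             ≡⟨ ∣m+n-m+o∣≡∣n-o∣ n b a ⟩
  ∣ b - a ∣                     ≡⟨ ∣-∣-comm b a ⟩
  ∣ a - b ∣                     ∎
  where
    open ≡-Reasoning
    rearrange : ∀ c d w → (c + d) + w ≡ (w + c) + d
    rearrange = solve-∀
    pad : ∀ w c d → w + c ≡ n → (c + d) + w ≡ n + d
    pad w c d w+c≡n = trans (rearrange c d w) (cong (_+ d) w+c≡n)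

opposite : ∀ {a b n u v} → u ≡ n + a → v + b ≡ n → ∣ u - v ∣ ≡ a + b
opposite {a} {b} {n} {u} {v} u≡n+a v+b≡n = begin
  ∣ u - v ∣           ≡⟨ cong (λ w → ∣ w - v ∣) u≡v+[b+a] ⟩
  ∣ v + (b + a) - v ∣ ≡⟨ ∣-∣-comm (v + (b + a)) v ⟩
  ∣ v - v + (b + a) ∣ ≡⟨ ∣m-m+n∣≡n v (b + a) ⟩
  b + a               ≡⟨ +-comm b a ⟩
  a + b               ∎
  where
    open ≡-Reasoning
    u≡v+[b+a] : u ≡ v + (b + a)
    u≡v+[b+a] = trans u≡n+a (trans (cong (_+ a) (sym v+b≡n)) (+-assoc v b a))

shifted-apart : ∀ {a b n u v} → Shifted a n u → Shifted b n v →
                a ⊓ b ≤ ∣ a - b ∣ → a ⊓ b ≤ ∣ u - v ∣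
shifted-apart {a} {b} {n} (inj₁ refl) (inj₁ refl) gap =
  subst (a ⊓ b ≤_) (sym (∣m+n-m+o∣≡∣n-o∣ n a b)) gap
shifted-apart {a} {b} (inj₂ u+a≡n) (inj₂ v+b≡n) gap =
  subst (a ⊓ b ≤_) (sym (both-down {a} {b} u+a≡n v+b≡n)) gap
shifted-apart {a} {b} (inj₁ u≡n+a) (inj₂ v+b≡n) _ =
  subst (a ⊓ b ≤_) (sym (opposite u≡n+a v+b≡n)) (m⊓n≤m+n a b)
shifted-apart {a} {b} {u = u} {v} (inj₂ u+a≡n) (inj₁ v≡n+b) _ =
  subst (a ⊓ b ≤_) (sym (trans (∣-∣-comm u v) (opposite v≡n+b u+a≡n)))
        (subst (_≤ b + a) (⊓-comm b a) (m⊓n≤m+n b a))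

doubled-apart : ∀ {p q} → p + p ≤ q → p ⊓ q ≤ ∣ p - q ∣
doubled-apart {p} {q} 2p≤q = begin
  p ⊓ q     ≤⟨ m⊓n≤m p q ⟩
  p         ≤⟨ m+n≤o⇒m≤o∸n p 2p≤q ⟩
  q ∸ p     ≡⟨ sym (m≤n⇒∣m-n∣≡n∸m p≤q) ⟩
  ∣ p - q ∣ ∎
  where
    open ≤-Reasoning
    p≤q : p ≤ q
    p≤q = ≤-trans (m≤m+n p p) 2p≤q

2^-double : ∀ x → 2 ^ x + 2 ^ x ≡ 2 ^ suc x
2^-double x = cong (2 ^ x +_) (sym (+-identityʳ (2 ^ x)))

2^-apart : ∀ {x y} → x ≢ y → 2 ^ x ⊓ 2 ^ y ≤ ∣ 2 ^ x - 2 ^ y ∣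
2^-apart {x} {y} x≢y with <-cmp x y
... | tri< x<y _ _ = doubled-apart (subst (_≤ 2 ^ y) (sym (2^-double x)) (^-monoʳ-≤ 2 x<y))
... | tri≈ _ x≡y _ = contradiction x≡y x≢y
... | tri> _ _ y<x = subst₂ _≤_ (⊓-comm (2 ^ y) (2 ^ x)) (∣-∣-comm (2 ^ y) (2 ^ x))
                       (doubled-apart (subst (_≤ 2 ^ x) (sym (2^-double y)) (^-monoʳ-≤ 2 y<x)))

quarter : ∀ {M n a} → (M + M) + (M + M) ≤ n → n < (a + a) + (a + a) → M ≤ a
quarter {M} {n} {a} 4M≤n n<4a = ≮⇒≥ λ a<M → <⇒≱ n<4a (≤-trans (quadruple (<⇒≤ a<M)) 4M≤n)
  where
    quadruple : a ≤ M → (a + a) + (a + a) ≤ (M + M) + (M + M)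
    quadruple a≤M = +-mono-≤ (+-mono-≤ a≤M a≤M) (+-mono-≤ a≤M a≤M)

module DivergentFamily
  (g : ℕ → ℕ → ℕ)
  (g-pos : ∀ i t → 0 < g i t)
  (doubling : ∀ i t → g i t + g i t ≤ g i (suc t))
  (separated : ∀ {i j} → i ≢ j → ∀ t s → g i t ⊓ g j s ≤ ∣ g i t - g j s ∣)
  where

  family : ℕ → InfPerm
  family i = BlockSwap.blockSwapPerm (g i) (g-pos i)

  -- At a position n ≥ 4 M, both permutations move n by at least M, and their
  -- shifts are separated, so their values are at least M apart.
  family-diverge : ∀ i j → i ≢ j → Diverge (family i) (family j)
  family-diverge i j i≢j M = (M + M) + (M + M) , far
    where
      open BlockSwap using (blockSwap)
      open BlockSwap.Shift using (blockSwap-shift)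
      far : ∀ n → (M + M) + (M + M) ≤ n →
            M ≤ ∣ blockSwap (g i) (g-pos i) n - blockSwap (g j) (g-pos j) n ∣
      far n 4M≤n with blockSwap-shift (g i) (g-pos i) (doubling i) n
                    | blockSwap-shift (g j) (g-pos j) (doubling j) n
      ... | t , n<4gᵢ , shiftedᵢ | s , n<4gⱼ , shiftedⱼ =
        ≤-trans (⊓-glb (quarter 4M≤n n<4gᵢ) (quarter 4M≤n n<4gⱼ))
                (shifted-apart shiftedᵢ shiftedⱼ (separated i≢j t s))

exponent : ℕ → ℕ → ℕ
exponent i t = (i + t) * (i + t) + i

exponent-< : ∀ i t j s → i + t < j + s → exponent i t < exponent j s
exponent-< i t j s lt = begin-strict
  (i + t) * (i + t) + i       ≤⟨ +-monoʳ-≤ ((i + t) * (i + t)) (m≤m+n i t) ⟩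
  (i + t) * (i + t) + (i + t) <⟨ s≤s (m≤m+n _ (i + t)) ⟩
  suc ((i + t) * (i + t) + (i + t) + (i + t)) ≡⟨ square-suc (i + t) ⟩
  suc (i + t) * suc (i + t)   ≤⟨ *-mono-≤ lt lt ⟩
  (j + s) * (j + s)           ≤⟨ m≤m+n ((j + s) * (j + s)) j ⟩
  (j + s) * (j + s) + j       ∎
  where
    open ≤-Reasoning
    square-suc : ∀ p → suc (p * p + p + p) ≡ suc p * suc p
    square-suc = solve-∀

exponent-injective : ∀ i t j s → exponent i t ≡ exponent j s → i ≡ j
exponent-injective i t j s eq with <-cmp (i + t) (j + s)
... | tri< lt _ _ = contradiction eq (<⇒≢ (exponent-< i t j s lt))
... | tri> _ _ gt = contradiction (sym eq) (<⇒≢ (exponent-< j s i t gt))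
... | tri≈ _ i+t≡j+s _ = +-cancelˡ-≡ ((j + s) * (j + s)) i j (subst (λ k → k * k + i ≡ exponent j s) i+t≡j+s eq)

growth : ℕ → ℕ → ℕ
growth i t = 2 ^ exponent i t

growth-doubling : ∀ i t → growth i t + growth i t ≤ growth i (suc t)
growth-doubling i t = subst (_≤ growth i (suc t)) (sym (2^-double (exponent i t)))
  (^-monoʳ-≤ 2 (exponent-< i t i (suc t) (+-monoʳ-< i (n<1+n t))))

growth-separated : ∀ {i j} → i ≢ j → ∀ t s → growth i t ⊓ growth j s ≤ ∣ growth i t - growth j s ∣
growth-separated i≢j t s = 2^-apart (λ eq → i≢j (exponent-injective _ t _ s eq))

theorem1 : Σ (ℕ → InfPerm) (λ P → ∀ (i j : ℕ) → i ≢ j → Diverge (P i) (P j))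
theorem1 = family , family-diverge
  where open DivergentFamily growth (λ i t → m^n>0 2 (exponent i t)) growth-doubling growth-separated
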